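{- Let $S$ be a partial commutative monoid, $R\subseteq S\times S$ a relation (program), and $\hat f_R:2^S\to 2^S$ its associated predicate transformer. Suppose $\hat f_R$ is local. Then for all $p,q,r\in 2^S$: if $\vdash\{p\}R\{q\}$ then $\vdash\{p\ast r\}R\{q\ast r\}$.
   Context: $S$ has an associative, commutative partial operation $\ast$ with a unit; on $2^S$, $\ast$ is the complex product $p\ast q=\{a\ast b\mid a\in p,b\in q,a\ast b\text{ defined}\}$ and the order is $\subseteq$. The state transformer of $R$ is $f_R(a)=\{b\mid(a,b)\in R\}$ and its predicate transformer is $\hat f_R(Y)=\{x\mid f_R(x)\subseteq Y\}$. Validity of a Hoare triple is $\vdash\{p\}R\{q\}$ iff $p\subseteq\hat f_R(q)$. A function $f:2^S\to2^S$ is local if $f\ast\mathit{id}\le f$, where $(f\ast g)(r)=\bigcup_{r=p\ast q}(f\,p)\ast(g\,q)$ (union over $p,q\in2^S$ with $p\ast q=r$), $\mathit{id}$ is the identity, and $\le$ is pointwise inclusion. -}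

module Defs where

import Level
open import Level using (0ℓ)
open import Data.Maybe using (Maybe; just; nothing; _>>=_)
open import Data.Product using (Σ; ∃; ∃-syntax; _×_; _,_)
open import Relation.Binary.PropositionalEquality using (_≡_)
open import Relation.Unary using (Pred; _⊆_; _⊇_)

-- A partial commutative monoid: the partial operation is a → b → Maybe S
-- (nothing = undefined).  Associativity is Kleene equality of the two
-- bracketings (both undefined, or both defined and equal).
record PCM : Set₁ where
  field
    Carrier : Set
    _∙_     : Carrier → Carrier → Maybe Carrier
    e       : Carrier
    comm    : ∀ a b → a ∙ b ≡ b ∙ a
    assoc   : ∀ a b c → ((a ∙ b) >>= λ ab → ab ∙ c) ≡ ((b ∙ c) >>= λ bc → a ∙ bc)
    unitˡ   : ∀ a → e ∙ a ≡ just a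

module _ (M : PCM) where
  open PCM M

  PSet : Set₁
  PSet = Pred Carrier 0ℓ

  _≐_ : PSet → PSet → Set
  p ≐ q = (p ⊆ q) × (q ⊆ p)

  _⊛_ : PSet → PSet → PSet
  (p ⊛ q) c = ∃[ a ] ∃[ b ] (p a × q b × (a ∙ b ≡ just c))

  -- (f ∗ g)(r) = ⋃_{p ∗ q = r} (f p) ∗ (g q)
  -- (lives one universe up, since the union ranges over all subsets p, q)
  _⊛F_ : (PSet → PSet) → (PSet → PSet) → (PSet → Pred Carrier (Level.suc 0ℓ))
  (f ⊛F g) r c = Σ PSet λ p → Σ PSet λ q → ((p ⊛ q) ≐ r) × ((f p ⊛ g q) c)

  Local : (PSet → PSet) → Set₁
  Local f = ∀ r → (f ⊛F (λ x → x)) r ⊆ f r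

  Rel : Set₁
  Rel = Carrier → Carrier → Set

  stateT : Rel → Carrier → PSet
  stateT R a b = R a b

  predT : Rel → PSet → PSet
  predT R Y x = stateT R x ⊆ Y

  Hoare : PSet → Rel → PSet → Set
  Hoare p R q = p ⊆ predT R q

module Submission where

-- Locality of a predicate transformer f says  (f ∗ id)(s) ⊆ f s  for every
-- s; instantiating the union defining (f ∗ id)(q ∗ r) at the split
-- (q, r) of q ∗ r gives the frame inclusion  f q ∗ r ⊆ f (q ∗ r)  for any
-- local f (no property of predicate transformers of programs is needed).
-- Since the complex product is monotone, a valid triple p ⊆ f̂_R q yields
--   p ∗ r  ⊆  f̂_R q ∗ r  ⊆  f̂_R (q ∗ r),
-- which is validity of {p ∗ r} R {q ∗ r}.

open import Defs
open import Data.Product using (_,_)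
open import Relation.Unary using (_⊆_)
open import Relation.Unary.Properties using (⊆-trans)

module _ (M : PCM) where

  ⊛-monoˡ : ∀ {p p′ : PSet M} (r : PSet M) → p ⊆ p′ → _⊛_ M p r ⊆ _⊛_ M p′ r
  ⊛-monoˡ r p⊆p′ (a , b , pa , rb , ab≡c) = a , b , p⊆p′ pa , rb , ab≡c

  local⇒frame : ∀ (f : PSet M → PSet M) → Local M f →
                ∀ (q r : PSet M) → _⊛_ M (f q) r ⊆ f (_⊛_ M q r)
  local⇒frame f loc q r fq⊛r = loc (_⊛_ M q r) (q , r , ≐-refl , fq⊛r)
    where
      ≐-refl : _≐_ M (_⊛_ M q r) (_⊛_ M q r)
      ≐-refl = (λ x → x) , (λ x → x)

lemma15p2 : (M : PCM) (R : Rel M) → Local M (predT M R) →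
    ∀ (p q r : PSet M) → Hoare M p R q → Hoare M (_⊛_ M p r) R (_⊛_ M q r)
lemma15p2 M R loc p q r p⊆f̂q =
  ⊆-trans {i = _⊛_ M p r} (⊛-monoˡ M r p⊆f̂q) (local⇒frame M (predT M R) loc q r)
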